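{- Let $b\ge1$ be an integer and $G$ a $(b+1)$-degenerate graph. In the $(1:b)$ component game on $G$ in which Maker moves first and Breaker plays according to $\mathcal{S}_B$, at every time during the game every H-comp $C$ satisfies $|V(C)|\le 2(b+1)$.
   Context: A graph is $(b+1)$-degenerate if it has no nonempty subgraph of minimum degree at least $b+2$. The $(b+2)$-peeling process: $G_0=G$, and $G_{t+1}$ is obtained from $G_t$ by deleting all edges incident with vertices of degree at most $b+1$ in $G_t$ (vertices are kept). The rank of a vertex is $\rho(v)=\min\{t\ge0:\deg_{G_t}(v)<b+2\}$. In the $(1:b)$ component game on $G$, each round consists of a move of Maker, who claims one unclaimed ("free") edge of $G$, followed by a move of Breaker, who claims $b$ free edges one at a time (each claim is a step). An edge $uv$ is horizontal if $\rho(u)=\rho(v)$ and vertical otherwise. An H-comp is a connected component (possibly a single vertex) of the graph on $V(G)$ whose edges are the horizontal edges claimed by Maker; its vertices share a rank $\rho(C)$. A vertical edge $e$ is above $C$ if its endpoint of smaller rank lies in $V(C)$. $F(C)$ is the set of free edges of $G_{\rho(C)}$ incident with $V(C)$; $F_V(C)$, $F_H(C)$ are its vertical and horizontal edges. Strategy $\mathcal{S}_B$: when Maker claims $e=uv$ with $\rho(u)\le\rho(v)$, let $C$ be the H-comp containing $u$ after her move; in each of his $b$ steps Breaker claims an arbitrary edge of $F_V(C)$ if nonempty, otherwise of $F_H(C)$ if nonempty, otherwise an arbitrary free edge. -}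

module Defs where

open import Data.Bool using (Bool; true; false; _∧_; if_then_else_)
open import Data.Nat using (ℕ; zero; suc; _+_; _<_; _≤_; _≤ᵇ_; _≡ᵇ_; _%_)
open import Data.Fin using (Fin)
open import Data.List using (List; []; _∷_; _∷ʳ_; length; filterᵇ; allFin)
open import Data.List.Relation.Unary.Any using (Any)
open import Data.List.Membership.Propositional using (_∈_)
open import Data.Maybe using (Maybe; just; nothing)
open import Data.Product using (Σ; _×_; _,_; proj₂; ∃)
open import Data.Sum using (_⊎_)
open import Data.Unit using (⊤)
open import Relation.Nullary using (¬_)
open import Relation.Binary.PropositionalEquality using (_≡_; _≢_)
open import Relation.Binary.Construct.Closure.ReflexiveTransitive using (Star)

record Graph (n : ℕ) : Set where
  field
    adj    : Fin n → Fin n → Bool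
    sym    : ∀ x y → adj x y ≡ adj y x
    irrefl : ∀ x → adj x x ≡ false
open Graph public

degreeIn : {n : ℕ} → (Fin n → Fin n → Bool) → Fin n → ℕ
degreeIn {n} A x = length (filterᵇ (A x) (allFin n))

record Subgraph {n : ℕ} (G : Graph n) : Set where
  field
    S     : Fin n → Bool
    H     : Fin n → Fin n → Bool
    Hsym  : ∀ x y → H x y ≡ H y x
    H⊆    : ∀ x y → H x y ≡ true → (adj G x y ≡ true) × (S x ≡ true) × (S y ≡ true)
open Subgraph public

Degenerate : {n : ℕ} → ℕ → Graph n → Set
Degenerate k G =
  ¬ (Σ (Subgraph G) λ K →
       (∃ λ v → S K v ≡ true) × (∀ v → S K v ≡ true → suc k ≤ degreeIn (H K) v))

-- (b+2)-peeling process: G_0 = G; G_{t+1} deletes all edges incident with a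
-- vertex of degree ≤ b+1 in G_t.
peel : {n : ℕ} → ℕ → Graph n → ℕ → Fin n → Fin n → Bool
peel b G zero x y = adj G x y
peel b G (suc t) x y =
  peel b G t x y ∧ ((b + 2 ≤ᵇ degreeIn (peel b G t) x) ∧ (b + 2 ≤ᵇ degreeIn (peel b G t) y))

IsRank : {n : ℕ} → ℕ → Graph n → Fin n → ℕ → Set
IsRank b G v r =
  (degreeIn (peel b G r) v < b + 2) × (∀ t → t < r → b + 2 ≤ degreeIn (peel b G t) v)

data Player : Set where
  maker breaker : Player

module Game {n : ℕ} (b : ℕ) (G : Graph n) (ρ : Fin n → ℕ) where

  Move : Set
  Move = Player × (Fin n × Fin n)

  -- chronological list of all claims so far (each step of Breaker is one claim)
  History : Set
  History = List Move

  -- whose step it is: rounds are Maker's claim followed by b Breaker claims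
  turn : History → Player
  turn h = if (length h % suc b) ≡ᵇ 0 then maker else breaker

  Claimed : History → Fin n → Fin n → Set
  Claimed h x y = Any (λ m → proj₂ m ≡ (x , y)) h

  Free : History → Fin n → Fin n → Set
  Free h x y = (adj G x y ≡ true) × ¬ Claimed h x y × ¬ Claimed h y x

  MakerEdge : History → Fin n → Fin n → Set
  MakerEdge h x y = ((maker , (x , y)) ∈ h) ⊎ ((maker , (y , x)) ∈ h)

  HEdge : History → Fin n → Fin n → Set
  HEdge h x y = MakerEdge h x y × ρ x ≡ ρ y

  SameH : History → Fin n → Fin n → Set
  SameH h = Star (HEdge h)

  lastMaker : History → Maybe (Fin n × Fin n)
  lastMaker [] = nothing
  lastMaker (m ∷ h) with lastMaker h
  ... | just e = just e
  lastMaker ((maker , e) ∷ h)   | nothing = just e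
  lastMaker ((breaker , e) ∷ h) | nothing = nothing

  lowEnd : Fin n × Fin n → Fin n
  lowEnd (u , v) = if ρ u ≤ᵇ ρ v then u else v

  -- F(C) for the H-comp C containing u: free edges of G_{ρ(C)} incident with V(C)
  FC : History → Fin n → Fin n → Fin n → Set
  FC h u x y = Free h x y × (peel b G (ρ u) x y ≡ true) × (SameH h u x ⊎ SameH h u y)

  FV : History → Fin n → Fin n → Fin n → Set
  FV h u x y = FC h u x y × ρ x ≢ ρ y

  FH : History → Fin n → Fin n → Fin n → Set
  FH h u x y = FC h u x y × ρ x ≡ ρ y

  SB : History → Fin n → Fin n → Set
  SB h x y with lastMaker h
  ... | nothing = ⊤
  ... | just e =
    let u = lowEnd e in
    FV h u x y
    ⊎ ((¬ (∃ λ a → ∃ λ c → FV h u a c)) × FH h u x y)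
    ⊎ ((¬ (∃ λ a → ∃ λ c → FV h u a c)) × (¬ (∃ λ a → ∃ λ c → FH h u a c)))

  Legal : History → Move → Set
  Legal h (p , (x , y)) = (p ≡ turn h) × Free h x y × (p ≡ breaker → SB h x y)

  data Play : History → Set where
    start : Play []
    move  : ∀ {h} (m : Move) → Play h → Legal h m → Play (h ∷ʳ m)

-- Weigh a set X of vertices of an H-comp by the sum over v ∈ X of 1 + (free degree of v in
-- G_{ρ(v)}); by the definition of rank every summand is at most b + 2, and every claim of an
-- edge of F(C) lowers the weight of C. At the start of each round every H-comp with F(C) ≠ ∅
-- weighs at most b + 2. A horizontal edge of Maker joins two such comps and uses up a free
-- edge at each of its ends, so the new comp weighs at most 2(b + 1); while its F(C) is
-- nonempty each of Breaker's b steps in the round lowers its weight by one more, back to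
-- b + 2. A comp with F(C) = ∅ never grows again, and the size of a comp is at most its weight.

module Submission where

open import Defs hiding (sym)
open import Data.Bool using (true; false; _∧_; T?)
open import Data.Bool.Properties using (∧-comm; T-≡) renaming (_≟_ to _≟ᵇ_)
open import Data.Empty using (⊥; ⊥-elim)
open import Data.Fin using (Fin)
open import Data.Fin.Properties using () renaming (_≟_ to _≟ᶠ_)
open import Data.List using (List; []; _∷_; _∷ʳ_; [_]; map; filter; length; allFin)
open import Data.List.Properties using (length-++)
open import Data.List.Membership.Propositional using (_∈_)
open import Data.List.Membership.Propositional.Properties using (∈-filter⁺; ∈-filter⁻; ∈-allFin)
open import Data.List.Relation.Binary.Equality.Propositional using (≋⇒≡)
open import Data.List.Relation.Binary.Sublist.Propositional as Sublist using (_⊆_; []; _∷_; ⊆-refl)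
open import Data.List.Relation.Binary.Sublist.Propositional.Properties
  using (All-resp-⊆; length-mono-≤; filter⁺; to-≋)
open import Data.List.Relation.Unary.All as All using (All; []; _∷_)
open import Data.List.Relation.Unary.All.Properties using (¬Any⇒All¬)
open import Data.List.Relation.Unary.AllPairs using ([]; _∷_)
open import Data.List.Relation.Unary.Any using (Any; here; there; any?; satisfied)
open import Data.List.Relation.Unary.Any.Properties using (++⁺ˡ; ++⁺ʳ; ++⁻)
open import Data.List.Relation.Unary.Unique.Propositional using (Unique)
open import Data.Maybe using (just; nothing)
open import Data.Nat using (ℕ; zero; suc; _+_; _*_; _≤_; _<_; _/_; _%_; _≤ᵇ_; z≤n; s≤s)
open import Data.Nat.DivMod using (m≡m%n+[m/n]*n; [m+kn]%n≡m%n; n%n≡0; m<n⇒m%n≡m; m%n<n)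
open import Data.Nat.ListAction using (sum)
open import Data.Nat.Properties
  using (_≟_; +-comm; +-assoc; +-suc; ≤-trans; ≤-reflexive; <⇒≤; ≤∧≢⇒<; ≤-pred;
         ≤⇒≤ᵇ; +-mono-≤; +-monoʳ-≤; +-monoˡ-≤; +-identityʳ; +-mono-<-≤; +-mono-≤-<;
         m≤n⇒m≤o+n; m≤m+n; +-cancelʳ-≤)
open import Data.Nat.Tactic.RingSolver using (solve-∀)
open import Data.Product using (∃; _×_; _,_; proj₁; proj₂; map₁)
open import Data.Product.Properties using (≡-dec)
open import Data.Sum using (_⊎_; inj₁; inj₂)
import Data.Sum as Sum
open import Function using (_∘_; Equivalence)
open import Relation.Nullary using (¬_; Dec; yes; no; ¬?)
open import Relation.Nullary.Decidable using (_×-dec_; toSum)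
open import Relation.Unary using (Decidable)
open import Relation.Binary.PropositionalEquality
  using (_≡_; _≢_; refl; sym; trans; cong; subst; module ≡-Reasoning)
open import Relation.Binary.Construct.Closure.ReflexiveTransitive
  using (Star; ε; _◅_; _◅◅_; fold; reverse) renaming (map to Star-map)

module _ {X : Set} {P Q : X → Set} (P? : Decidable P) (Q? : Decidable Q)
  (P⇒Q : ∀ {x} → P x → Q x) where

  filter-⊆-filter : ∀ xs → filter P? xs ⊆ filter Q? xs
  filter-⊆-filter xs = filter⁺ P? Q? (λ { refl → P⇒Q }) (⊆-refl {x = xs})

  length-filter-mono : ∀ xs → length (filter P? xs) ≤ length (filter Q? xs)
  length-filter-mono xs = length-mono-≤ (filter-⊆-filter xs)

  length-filter-< : ∀ {y xs} → y ∈ xs → ¬ P y → Q y →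
    length (filter P? xs) < length (filter Q? xs)
  length-filter-< {y} {xs} y∈xs ¬Py Qy = ≤∧≢⇒< (length-filter-mono xs) lengths-differ
    where
      lengths-differ : length (filter P? xs) ≢ length (filter Q? xs)
      lengths-differ eq = ¬Py (proj₂ (∈-filter⁻ P? {xs = xs} (subst (y ∈_) (sym same) y∈filterQ)))
        where
          same = ≋⇒≡ (to-≋ eq (filter-⊆-filter xs))
          y∈filterQ = ∈-filter⁺ Q? y∈xs Qy

module _ {X : Set} where

  sum-map-mono : ∀ {f g : X → ℕ} → (∀ x → f x ≤ g x) → ∀ xs → sum (map f xs) ≤ sum (map g xs)
  sum-map-mono f≤g []       = z≤n
  sum-map-mono f≤g (x ∷ xs) = +-mono-≤ (f≤g x) (sum-map-mono f≤g xs)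

  sum-map-< : ∀ {f g : X → ℕ} → (∀ x → f x ≤ g x) → ∀ {y xs} → y ∈ xs → f y < g y →
    sum (map f xs) < sum (map g xs)
  sum-map-< f≤g {xs = _ ∷ xs} (here refl) fy<gy = +-mono-<-≤ fy<gy (sum-map-mono f≤g xs)
  sum-map-< f≤g {xs = x ∷ _}  (there y∈)  fy<gy = +-mono-≤-< (f≤g x) (sum-map-< f≤g y∈ fy<gy)

  length≤sum-map-suc : ∀ (f : X → ℕ) xs → length xs ≤ sum (map (suc ∘ f) xs)
  length≤sum-map-suc f []       = z≤n
  length≤sum-map-suc f (x ∷ xs) = s≤s (m≤n⇒m≤o+n (f x) (length≤sum-map-suc f xs))

  Unique-resp-⊇ : ∀ {xs ys : List X} → xs ⊆ ys → Unique ys → Unique xs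
  Unique-resp-⊇ []               []       = []
  Unique-resp-⊇ (_ Sublist.∷ʳ τ) (_ ∷ u)  = Unique-resp-⊇ τ u
  Unique-resp-⊇ (refl ∷ τ)       (y∉ ∷ u) = All-resp-⊆ τ y∉ ∷ Unique-resp-⊇ τ u

  All⊎⇒All⊎Any : ∀ {A B : X → Set} {xs} → All (λ x → A x ⊎ B x) xs → All A xs ⊎ Any B xs
  All⊎⇒All⊎Any []             = inj₁ []
  All⊎⇒All⊎Any (inj₂ b ∷ _)   = inj₂ (here b)
  All⊎⇒All⊎Any (inj₁ a ∷ abs) = Sum.map (a ∷_) there (All⊎⇒All⊎Any abs)

  record Split (A B : X → Set) (xs : List X) : Set where
    field
      left right : List X
      left⊆      : left ⊆ xs
      right⊆     : right ⊆ xs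
      all-left   : All A left
      all-right  : All B right
      sum-split  : ∀ (f : X → ℕ) → sum (map f xs) ≡ sum (map f left) + sum (map f right)

  split : ∀ {A B : X → Set} {xs} → All (λ x → A x ⊎ B x) xs → Split A B xs
  split [] = record { left = [] ; right = [] ; left⊆ = [] ; right⊆ = []
                    ; all-left = [] ; all-right = [] ; sum-split = λ _ → refl }
  split {xs = x ∷ _} (inj₁ a ∷ abs) = record
    { left = x ∷ left ; right = right ; left⊆ = refl ∷ left⊆ ; right⊆ = x Sublist.∷ʳ right⊆
    ; all-left = a ∷ all-left ; all-right = all-right
    ; sum-split = λ f → trans (cong (f x +_) (sum-split f)) (sym (+-assoc (f x) _ _)) }
    where open Split (split abs)
  split {xs = x ∷ _} (inj₂ b ∷ abs) = record
    { left = left ; right = x ∷ right ; left⊆ = x Sublist.∷ʳ left⊆ ; right⊆ = refl ∷ right⊆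
    ; all-left = all-left ; all-right = b ∷ all-right
    ; sum-split = λ f → trans (cong (f x +_) (sum-split f))
                              (+-exchange (f x) (sum (map f left)) (sum (map f right))) }
    where
      open Split (split abs)
      +-exchange : ∀ m n o → m + (n + o) ≡ n + (m + o)
      +-exchange = solve-∀

  sum-map-≤-union : ∀ (f : X → ℕ) {A B : X → Set} {α β} →
    (∀ {ys} → Unique ys → All A ys → sum (map f ys) ≤ α) →
    (∀ {zs} → Unique zs → All B zs → sum (map f zs) ≤ β) →
    ∀ {xs} → Unique xs → All (λ x → A x ⊎ B x) xs → sum (map f xs) ≤ α + β
  sum-map-≤-union f boundA boundB u abs =
    ≤-trans (≤-reflexive (sum-split f))
      (+-mono-≤ (boundA (Unique-resp-⊇ left⊆ u) all-left) (boundB (Unique-resp-⊇ right⊆ u) all-right))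
    where open Split (split abs)

[1+m]%n≡[1+m%n]%n : ∀ m d → suc m % suc d ≡ suc (m % suc d) % suc d
[1+m]%n≡[1+m%n]%n m d = begin
  suc m % suc d                                  ≡⟨ cong (λ k → suc k % suc d) (m≡m%n+[m/n]*n m (suc d)) ⟩
  (suc (m % suc d) + m / suc d * suc d) % suc d  ≡⟨ [m+kn]%n≡m%n (suc (m % suc d)) (m / suc d) (suc d) ⟩
  suc (m % suc d) % suc d                        ∎
  where open ≡-Reasoning

suc-%-cases : ∀ m d → (suc m % suc d ≡ 0 × m % suc d ≡ d) ⊎ suc m % suc d ≡ suc (m % suc d)
suc-%-cases m d with m % suc d ≟ d
... | yes r≡d = inj₁ (trans ([1+m]%n≡[1+m%n]%n m d)
                           (subst (λ r → suc r % suc d ≡ 0) (sym r≡d) (n%n≡0 (suc d))) , r≡d)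
... | no  r≢d = inj₂ (trans ([1+m]%n≡[1+m%n]%n m d)
                           (m<n⇒m%n≡m (s≤s (≤∧≢⇒< (≤-pred (m%n<n m (suc d))) r≢d))))

module ComponentBound {n : ℕ} (b : ℕ) (G : Graph n) (ρ : Fin n → ℕ)
  (ρ-rank : ∀ v → IsRank b G v (ρ v)) where

  open Game b G ρ

  peel-sym : ∀ t x y → peel b G t x y ≡ peel b G t y x
  peel-sym zero    x y = Graph.sym G x y
  peel-sym (suc t) x y rewrite peel-sym t x y =
    cong (peel b G t y x ∧_) (∧-comm (b + 2 ≤ᵇ degreeIn (peel b G t) x) _)

  peel-survives : ∀ t {x y} → adj G x y ≡ true → t ≤ ρ x → t ≤ ρ y → peel b G t x y ≡ true
  peel-survives zero    xy _ _ = xy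
  peel-survives (suc t) {x} {y} xy t<ρx t<ρy
    rewrite peel-survives t xy (<⇒≤ t<ρx) (<⇒≤ t<ρy)
          | Equivalence.to T-≡ (≤⇒≤ᵇ (proj₂ (ρ-rank x) t t<ρx))
          | Equivalence.to T-≡ (≤⇒≤ᵇ (proj₂ (ρ-rank y) t t<ρy)) = refl

  open import Data.List.Membership.DecPropositional (_≟ᶠ_ {n}) using (_∈?_)

  Claimed? : ∀ h x y → Dec (Claimed h x y)
  Claimed? h x y = any? (λ m → ≡-dec _≟ᶠ_ _≟ᶠ_ (proj₂ m) (x , y)) h

  Claimed-∷ʳ : ∀ {h} m {x y} → Claimed h x y → Claimed (h ∷ʳ m) x y
  Claimed-∷ʳ m = ++⁺ˡ

  Claimed-last : ∀ h p {x y} → Claimed (h ∷ʳ (p , (x , y))) x y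
  Claimed-last h p = ++⁺ʳ h (here refl)

  Free-∷ʳ⁻ : ∀ {h} m {x y} → Free (h ∷ʳ m) x y → Free h x y
  Free-∷ʳ⁻ m (xy , ¬xy , ¬yx) = xy , ¬xy ∘ Claimed-∷ʳ m , ¬yx ∘ Claimed-∷ʳ m

  Free-sym : ∀ {h x y} → Free h x y → Free h y x
  Free-sym {x = x} {y} (xy , ¬xy , ¬yx) = trans (Graph.sym G y x) xy , ¬yx , ¬xy

  Open : History → Fin n → Fin n → Set
  Open h x y = Free h x y × peel b G (ρ x) x y ≡ true

  Open? : ∀ h x → Decidable (Open h x)
  Open? h x y = ((adj G x y ≟ᵇ true) ×-dec ¬? (Claimed? h x y) ×-dec ¬? (Claimed? h y x))
                ×-dec (peel b G (ρ x) x y ≟ᵇ true)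

  freeDeg : History → Fin n → ℕ
  freeDeg h x = length (filter (Open? h x) (allFin n))

  freeDeg<b+2 : ∀ h x → freeDeg h x < b + 2
  freeDeg<b+2 h x = ≤-trans (s≤s (length-filter-mono (Open? h x) (T? ∘ peel b G (ρ x) x)
                                   (Equivalence.from T-≡ ∘ proj₂) (allFin n)))
                            (proj₁ (ρ-rank x))

  freeDeg-∷ʳ : ∀ h m x → freeDeg (h ∷ʳ m) x ≤ freeDeg h x
  freeDeg-∷ʳ h m x =
    length-filter-mono (Open? (h ∷ʳ m) x) (Open? h x) (map₁ (Free-∷ʳ⁻ m)) (allFin n)

  freeDeg-drop : ∀ {h} m {x y} → Open h x y → Claimed (h ∷ʳ m) x y ⊎ Claimed (h ∷ʳ m) y x →
    freeDeg (h ∷ʳ m) x < freeDeg h x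
  freeDeg-drop {h} m {x} {y} xy claimed =
    length-filter-< (Open? (h ∷ʳ m) x) (Open? h x) (map₁ (Free-∷ʳ⁻ m))
      (∈-allFin y) (λ { ((_ , ¬xy , ¬yx) , _) → Sum.[ ¬xy , ¬yx ] claimed }) xy

  HEdge-sym : ∀ {h x y} → HEdge h x y → HEdge h y x
  HEdge-sym (e , r) = Sum.swap e , sym r

  SameH-sym : ∀ {h x y} → SameH h x y → SameH h y x
  SameH-sym = reverse HEdge-sym

  SameH-rank : ∀ {h x y} → SameH h x y → ρ x ≡ ρ y
  SameH-rank = fold (λ x y → ρ x ≡ ρ y) (λ e r → trans (proj₂ e) r) refl

  SameH-mono : ∀ {h h′} → (∀ {x y} → MakerEdge h x y → MakerEdge h′ x y) →
    ∀ {x y} → SameH h x y → SameH h′ x y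
  SameH-mono f = Star-map (map₁ f)

  ∈-∷ʳ⁻ : ∀ {h : History} {m mv} → mv ∈ h ∷ʳ m → mv ∈ h ⊎ mv ≡ m
  ∈-∷ʳ⁻ {h} mv∈ with ++⁻ h mv∈
  ... | inj₁ old        = inj₁ old
  ... | inj₂ (here new) = inj₂ new

  MakerEdge-∷ʳ : ∀ {h} m {x y} → MakerEdge h x y → MakerEdge (h ∷ʳ m) x y
  MakerEdge-∷ʳ m = Sum.map ++⁺ˡ ++⁺ˡ

  MakerEdge-breaker⁻ : ∀ {h} e {x y} → MakerEdge (h ∷ʳ (breaker , e)) x y → MakerEdge h x y
  MakerEdge-breaker⁻ {h} e = Sum.map makers-move makers-move
    where
      makers-move : ∀ {e′} → (maker , e′) ∈ h ∷ʳ (breaker , e) → (maker , e′) ∈ h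
      makers-move mv∈ with ∈-∷ʳ⁻ {h} mv∈
      ... | inj₁ old = old

  MakerEdge-maker⁻ : ∀ {h} p q {x y} → MakerEdge (h ∷ʳ (maker , (p , q))) x y →
    MakerEdge h x y ⊎ (x ≡ p × y ≡ q) ⊎ (x ≡ q × y ≡ p)
  MakerEdge-maker⁻ {h} p q (inj₁ xy∈) with ∈-∷ʳ⁻ {h} xy∈
  ... | inj₁ old = inj₁ (inj₁ old)
  ... | inj₂ refl = inj₂ (inj₁ (refl , refl))
  MakerEdge-maker⁻ {h} p q (inj₂ yx∈) with ∈-∷ʳ⁻ {h} yx∈
  ... | inj₁ old = inj₁ (inj₂ old)
  ... | inj₂ refl = inj₂ (inj₂ (refl , refl))

  ThroughNewEdge : History → Fin n → Fin n → Fin n → Fin n → Set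
  ThroughNewEdge h p q a c = ρ p ≡ ρ q × (SameH h a p ⊎ SameH h a q) × (SameH h p c ⊎ SameH h q c)

  SameH-maker⁻ : ∀ h p q {a c} → SameH (h ∷ʳ (maker , (p , q))) a c →
    SameH h a c ⊎ ThroughNewEdge h p q a c
  SameH-maker⁻ h p q ε = inj₁ ε
  SameH-maker⁻ h p q ((ab , r) ◅ bc) with MakerEdge-maker⁻ p q ab | SameH-maker⁻ h p q bc
  ... | inj₁ old | inj₁ bc′ = inj₁ ((old , r) ◅ bc′)
  ... | inj₁ old | inj₂ (r′ , bpq , pqc) = inj₂ (r′ , Sum.map ((old , r) ◅_) ((old , r) ◅_) bpq , pqc)
  ... | inj₂ (inj₁ (refl , refl)) | inj₁ qc            = inj₂ (r , inj₁ ε , inj₂ qc)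
  ... | inj₂ (inj₁ (refl , refl)) | inj₂ (_ , _ , pqc) = inj₂ (r , inj₁ ε , pqc)
  ... | inj₂ (inj₂ (refl , refl)) | inj₁ pc            = inj₂ (sym r , inj₂ ε , inj₁ pc)
  ... | inj₂ (inj₂ (refl , refl)) | inj₂ (_ , _ , pqc) = inj₂ (sym r , inj₂ ε , pqc)

  lastMaker-maker : ∀ (h : History) e → lastMaker (h ∷ʳ (maker , e)) ≡ just e
  lastMaker-maker []      e = refl
  lastMaker-maker (m ∷ h) e rewrite lastMaker-maker h e = refl

  lastMaker-breaker : ∀ (h : History) e → lastMaker (h ∷ʳ (breaker , e)) ≡ lastMaker h
  lastMaker-breaker []      e = refl
  lastMaker-breaker (m ∷ h) e rewrite lastMaker-breaker h e with lastMaker h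
  ... | just _ = refl
  lastMaker-breaker ((maker , _) ∷ h)   e | nothing = refl
  lastMaker-breaker ((breaker , _) ∷ h) e | nothing = refl

  Exhausted : History → Fin n → Set
  Exhausted h w = ∀ x y → ¬ FC h w x y

  free-horizontal-in-F : ∀ {h w p q} → Free h p q → ρ p ≡ ρ q →
    SameH h w p ⊎ SameH h w q → FC h w p q
  free-horizontal-in-F {w = w} fpq r (inj₁ wp) =
    fpq , peel-survives (ρ w) (proj₁ fpq) (≤-reflexive (SameH-rank wp))
                                          (≤-reflexive (trans (SameH-rank wp) r)) , inj₁ wp
  free-horizontal-in-F {w = w} fpq r (inj₂ wq) =
    fpq , peel-survives (ρ w) (proj₁ fpq) (≤-reflexive (trans (SameH-rank wq) (sym r)))
                                          (≤-reflexive (SameH-rank wq)) , inj₂ wq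

  FC-claim-drops : ∀ {h u x y} pl → FC h u x y →
    ∃ λ z → SameH h u z × freeDeg (h ∷ʳ (pl , (x , y))) z < freeDeg h z
  FC-claim-drops {h} {u} {x} {y} pl (fxy , uxy , inj₁ ux) =
    x , ux , freeDeg-drop _ (fxy , subst (λ t → peel b G t x y ≡ true) (SameH-rank ux) uxy)
                         (inj₁ (Claimed-last h pl))
  FC-claim-drops {h} {u} {x} {y} pl (fxy , uxy , inj₂ uy) =
    y , uy , freeDeg-drop _ (Free-sym fxy , subst (λ t → peel b G t y x ≡ true) (SameH-rank uy)
                                                   (trans (peel-sym (ρ u) y x) uxy))
                         (inj₂ (Claimed-last h pl))

  Exhausted-resp-SameH : ∀ {h u w} → SameH h u w → Exhausted h u → Exhausted h w
  Exhausted-resp-SameH uw ex x y (fxy , wxy , wx⊎wy) =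
    ex x y (fxy , subst (λ t → peel b G t x y ≡ true) (sym (SameH-rank uw)) wxy ,
            Sum.map (uw ◅◅_) (uw ◅◅_) wx⊎wy)

  Exhausted-breaker : ∀ {h} e {w} → Exhausted h w → Exhausted (h ∷ʳ (breaker , e)) w
  Exhausted-breaker e ex x y (fxy , wxy , wx⊎wy) =
    ex x y (Free-∷ʳ⁻ _ fxy , wxy , Sum.map old old wx⊎wy)
    where old = SameH-mono (MakerEdge-breaker⁻ e)

  -- A comp with F(C) = ∅ cannot be joined by Maker, since the joining edge would lie in F(C).
  Exhausted-maker : ∀ {h p q w} → Free h p q → Exhausted h w → Exhausted (h ∷ʳ (maker , (p , q))) w
  Exhausted-maker {h} {p} {q} {w} fpq ex x y (fxy , wxy , wx⊎wy) =
    Sum.[ still-old inj₁ , still-old inj₂ ] wx⊎wy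
    where
      still-old : ∀ {d} → (SameH h w d → SameH h w x ⊎ SameH h w y) →
        SameH (h ∷ʳ (maker , (p , q))) w d → ⊥
      still-old into wd with SameH-maker⁻ h p q wd
      ... | inj₁ wd′ = ex x y (Free-∷ʳ⁻ _ fxy , wxy , into wd′)
      ... | inj₂ (r , wpq , _) = ex p q (free-horizontal-in-F fpq r wpq)

  weight : History → List (Fin n) → ℕ
  weight h xs = sum (map (suc ∘ freeDeg h) xs)

  weight-∷ʳ : ∀ h m xs → weight (h ∷ʳ m) xs ≤ weight h xs
  weight-∷ʳ h m = sum-map-mono (λ x → s≤s (freeDeg-∷ʳ h m x))

  -- If z is already listed its term drops; otherwise listing z adds at least one.
  weight-drop : ∀ {h m} {P : Fin n → Set} {xs z} → Unique xs → All P xs → P z →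
    freeDeg (h ∷ʳ m) z < freeDeg h z →
    ∃ λ ys → Unique ys × All P ys × weight (h ∷ʳ m) xs < weight h ys
  weight-drop {h} {m} {xs = xs} {z} u pxs pz drop with z ∈? xs
  ... | yes z∈xs = xs , u , pxs , sum-map-< (λ x → s≤s (freeDeg-∷ʳ h m x)) z∈xs (s≤s drop)
  ... | no  z∉xs = z ∷ xs , ¬Any⇒All¬ xs z∉xs ∷ u , pz ∷ pxs ,
                   s≤s (m≤n⇒m≤o+n (freeDeg h z) (weight-∷ʳ h m xs))

  phase : History → ℕ
  phase h = length h % suc b

  phase-∷ʳ : ∀ h m → (phase (h ∷ʳ m) ≡ 0 × phase h ≡ b) ⊎ phase (h ∷ʳ m) ≡ suc (phase h)
  phase-∷ʳ h m rewrite length-++ h {[ m ]} | +-comm (length h) 1 = suc-%-cases (length h) b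

  phase-maker-turn : ∀ h → turn h ≡ maker → phase h ≡ 0
  phase-maker-turn h t with phase h
  ... | zero = refl
  phase-maker-turn h () | suc _

  phase-after-maker : 1 ≤ b → ∀ h m → phase h ≡ 0 → phase (h ∷ʳ m) ≡ 1
  phase-after-maker 1≤b h m ph≡0 with phase-∷ʳ h m
  ... | inj₁ (_ , ph≡b) with () ← subst (1 ≤_) (trans (sym ph≡b) ph≡0) 1≤b
  ... | inj₂ ph′ = trans ph′ (cong suc ph≡0)

  lowEnd-either : ∀ {P : Fin n → Set} {u v} → P u → P v → P (lowEnd (u , v))
  lowEnd-either {u = u} {v} pu pv with ρ u ≤ᵇ ρ v
  ... | true  = pu
  ... | false = pv

  InMakersComp : History → Fin n → Set
  InMakersComp h w = ∃ λ e → lastMaker h ≡ just e × SameH h (lowEnd e) w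

  -- pending: inside a round, Maker's comp may weigh more than b + 2, but by at most the
  -- number b + 1 - phase h of Breaker steps left in the round, each of which lowers its weight.
  data Budget (h : History) (w : Fin n) (xs : List (Fin n)) : Set where
    settled : weight h xs ≤ b + 2 → Budget h w xs
    pending : 1 ≤ phase h → InMakersComp h w → weight h xs + phase h ≤ 2 * (b + 1) + 1 →
              Budget h w xs

  Budget⇒length≤ : ∀ {h w xs} → Budget h w xs → length xs ≤ 2 * (b + 1)
  Budget⇒length≤ {h} {xs = xs} (settled le) =
    ≤-trans (length≤sum-map-suc (freeDeg h) xs)
            (≤-trans le (≤-trans (m≤m+n (b + 2) b) (≤-reflexive (eq b))))
    where
      eq : ∀ b → b + 2 + b ≡ 2 * (b + 1)
      eq = solve-∀
  Budget⇒length≤ {h} {xs = xs} (pending 1≤ph _ le) =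
    ≤-trans (length≤sum-map-suc (freeDeg h) xs)
            (+-cancelʳ-≤ 1 (weight h xs) (2 * (b + 1)) (≤-trans (+-monoʳ-≤ (weight h xs) 1≤ph) le))

  settled-at-round-start : ∀ {h w xs} → phase h ≡ 0 → Budget h w xs → weight h xs ≤ b + 2
  settled-at-round-start _    (settled le)        = le
  settled-at-round-start ph≡0 (pending 1≤ph _ _) with () ← subst (1 ≤_) ph≡0 1≤ph

  Invariant : History → Set
  Invariant h = ∀ w xs → Unique xs → All (SameH h w) xs →
    length xs ≤ 2 * (b + 1) × (¬ Exhausted h w → Budget h w xs)

  SameH-[] : ∀ {w x} → SameH [] w x → w ≡ x
  SameH-[] ε                   = refl
  SameH-[] ((inj₁ () , _) ◅ _)
  SameH-[] ((inj₂ () , _) ◅ _)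

  invariant-start : Invariant []
  invariant-start w []           _ _ = z≤n , λ _ → settled z≤n
  invariant-start w (x ∷ [])     _ _ = Budget⇒length≤ singleton , λ _ → singleton
    where
      singleton : Budget [] w (x ∷ [])
      singleton = settled (≤-trans (≤-reflexive (+-identityʳ _)) (freeDeg<b+2 [] x))
  invariant-start w (x ∷ y ∷ _) ((x≢y ∷ _) ∷ _) (wx ∷ wy ∷ _) =
    ⊥-elim (x≢y (trans (sym (SameH-[] wx)) (SameH-[] wy)))

  module MakerMove (1≤b : 1 ≤ b) (h : History) (p q : Fin n) (inv : Invariant h)
    (ph≡0 : phase h ≡ 0) (fpq : Free h p q) where

    h′ : History
    h′ = h ∷ʳ (maker , (p , q))

    side-bound : ∀ {c} → FC h c p q → ∀ {ys} → Unique ys → All (SameH h c) ys →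
      weight h′ ys ≤ b + 1
    side-bound fc u cys with FC-claim-drops maker fc
    ... | z , cz , drop with weight-drop u cys cz drop
    ...   | ys′ , u′ , cys′ , lt = ≤-pred (≤-trans lt (≤-trans settled′ (≤-reflexive (+-suc b 1))))
      where settled′ = settled-at-round-start ph≡0 (proj₂ (inv _ ys′ u′ cys′) (λ ex → ex p q fc))

    merged : ∀ {w xs} → Unique xs → All (SameH h′ w) xs → ρ p ≡ ρ q → SameH h w p ⊎ SameH h w q →
      Budget h′ w xs
    merged {w} {xs} u wxs r wpq = pending (≤-reflexive (sym phase′)) in-comp bound
      where
        phase′ : phase h′ ≡ 1
        phase′ = phase-after-maker 1≤b h _ ph≡0

        new : ∀ {a c} → ρ a ≡ ρ c → (maker , (a , c)) ∈ h′ ⊎ (maker , (c , a)) ∈ h′ → SameH h′ a c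
        new r e = (e , r) ◅ ε

        last : (maker , (p , q)) ∈ h′
        last = ++⁺ʳ h (here refl)

        pw : SameH h′ p w
        pw = Sum.[ (λ wp → SameH-mono (MakerEdge-∷ʳ _) (SameH-sym wp))
                 , (λ wq → new r (inj₁ last) ◅◅ SameH-mono (MakerEdge-∷ʳ _) (SameH-sym wq)) ] wpq

        in-comp : InMakersComp h′ w
        in-comp = (p , q) , lastMaker-maker h (p , q) ,
                  lowEnd-either {λ v → SameH h′ v w} pw (new (sym r) (inj₂ last) ◅◅ pw)

        to-side : ∀ {x} → SameH h′ w x → SameH h p x ⊎ SameH h q x
        to-side wx with SameH-maker⁻ h p q wx
        ... | inj₁ wx′           = Sum.map (λ wp → SameH-sym wp ◅◅ wx′) (λ wq → SameH-sym wq ◅◅ wx′) wpq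
        ... | inj₂ (_ , _ , pqx) = pqx

        bound : weight h′ xs + phase h′ ≤ 2 * (b + 1) + 1
        bound = subst (λ t → weight h′ xs + t ≤ 2 * (b + 1) + 1) (sym phase′)
          (+-monoˡ-≤ 1 (≤-trans
            (sum-map-≤-union (suc ∘ freeDeg h′)
              (side-bound (free-horizontal-in-F fpq r (inj₁ ε)))
              (side-bound (free-horizontal-in-F fpq r (inj₂ ε)))
              u (All.map to-side wxs))
            (≤-reflexive (eq b))))
          where
            eq : ∀ b → b + 1 + (b + 1) ≡ 2 * (b + 1)
            eq = solve-∀

    unchanged : ∀ {w xs} → Unique xs → All (SameH h w) xs →
      length xs ≤ 2 * (b + 1) × (¬ Exhausted h′ w → Budget h′ w xs)
    unchanged {xs = xs} u wxs with inv _ xs u wxs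
    ... | size , budget = size , λ ¬ex →
      settled (≤-trans (weight-∷ʳ h _ xs) (settled-at-round-start ph≡0 (budget (¬ex ∘ Exhausted-maker fpq))))

    invariant-maker : Invariant h′
    invariant-maker w xs u wxs with All⊎⇒All⊎Any (All.map (SameH-maker⁻ h p q) wxs)
    ... | inj₁ wxs-old = unchanged u wxs-old
    ... | inj₂ through with satisfied through
    ...   | _ , (r , wpq , _) = Budget⇒length≤ (merged u wxs r wpq) , λ _ → merged u wxs r wpq

  SB-target : ∀ {h x y e} → lastMaker h ≡ just e → SB h x y →
    FC h (lowEnd e) x y ⊎ Exhausted h (lowEnd e)
  SB-target {h} {x} {y} {e} lm sb with lastMaker h | lm
  ... | just .e | refl with sb
  ...   | inj₁ (fc , _)              = inj₁ fc
  ...   | inj₂ (inj₁ (_ , (fc , _))) = inj₁ fc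
  ...   | inj₂ (inj₂ (¬fv , ¬fh))    = inj₂ λ a c fc →
    Sum.[ (λ r → ¬fh (a , c , fc , r)) , (λ r → ¬fv (a , c , fc , r)) ] (toSum (ρ a ≟ ρ c))

  round-end : ∀ {w} → suc w + b ≤ 2 * (b + 1) + 1 → w ≤ b + 2
  round-end {w} le = +-cancelʳ-≤ b w (b + 2) (≤-pred (≤-trans le (≤-reflexive (eq b))))
    where
      eq : ∀ b → 2 * (b + 1) + 1 ≡ suc (b + 2 + b)
      eq = solve-∀

  InMakersComp-breaker : ∀ {h} e {w} → InMakersComp h w → InMakersComp (h ∷ʳ (breaker , e)) w
  InMakersComp-breaker {h} e (e′ , lm , ew) =
    e′ , trans (lastMaker-breaker h e) lm , SameH-mono (MakerEdge-∷ʳ _) ew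

  Budget-breaker : ∀ {h w xs} e → InMakersComp h w →
    suc (weight (h ∷ʳ (breaker , e)) xs) + phase h ≤ 2 * (b + 1) + 1 → Budget (h ∷ʳ (breaker , e)) w xs
  Budget-breaker {h} {xs = xs} e in-comp le with phase-∷ʳ h (breaker , e)
  ... | inj₁ (_ , ph≡b) =
    settled (round-end (subst (λ t → suc (weight h′ xs) + t ≤ 2 * (b + 1) + 1) ph≡b le))
    where h′ = h ∷ʳ (breaker , e)
  ... | inj₂ ph′ = pending (≤-trans (s≤s z≤n) (≤-reflexive (sym ph′))) (InMakersComp-breaker e in-comp)
    (subst (λ t → weight h′ xs + t ≤ 2 * (b + 1) + 1) (sym ph′)
           (≤-trans (≤-reflexive (+-suc (weight h′ xs) (phase h))) le))
    where h′ = h ∷ʳ (breaker , e)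

  module BreakerMove (h : History) (x y : Fin n) (inv : Invariant h)
    (follows-SB : ∀ {e} → lastMaker h ≡ just e → FC h (lowEnd e) x y ⊎ Exhausted h (lowEnd e)) where

    h′ : History
    h′ = h ∷ʳ (breaker , (x , y))

    in-makers-comp : ∀ {w xs} → Unique xs → All (SameH h w) xs → ¬ Exhausted h w →
      InMakersComp h w → Budget h′ w xs
    in-makers-comp {xs = xs} u wxs ¬ex (e , lm , ew) with follows-SB lm
    ... | inj₂ ex = ⊥-elim (¬ex (Exhausted-resp-SameH ew ex))
    ... | inj₁ fc with FC-claim-drops breaker fc
    ...   | z , ez , drop with weight-drop u wxs (SameH-sym ew ◅◅ ez) drop
    ...     | ys , u′ , wys , lt with proj₂ (inv _ ys u′ wys) ¬ex
    ...       | settled le = settled (<⇒≤ (≤-trans lt le))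
    ...       | pending _ _ le = Budget-breaker (x , y) (e , lm , ew) (≤-trans (+-monoˡ-≤ _ lt) le)

    invariant-breaker : Invariant h′
    invariant-breaker w xs u wxs′ = proj₁ (inv w xs u wxs) , budget
      where
        wxs : All (SameH h w) xs
        wxs = All.map (SameH-mono (MakerEdge-breaker⁻ (x , y))) wxs′

        budget : ¬ Exhausted h′ w → Budget h′ w xs
        budget ¬ex′ with proj₂ (inv w xs u wxs) (¬ex′ ∘ Exhausted-breaker (x , y))
        ... | settled le          = settled (≤-trans (weight-∷ʳ h _ xs) le)
        ... | pending _ in-comp _ = in-makers-comp u wxs (¬ex′ ∘ Exhausted-breaker (x , y)) in-comp

  invariant : 1 ≤ b → ∀ {h} → Play h → Invariant h
  invariant 1≤b start = invariant-start
  invariant 1≤b (move {h} (maker , (p , q)) play (maker≡turn , fpq , _)) =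
    MakerMove.invariant-maker 1≤b h p q (invariant 1≤b play) (phase-maker-turn h (sym maker≡turn)) fpq
  invariant 1≤b (move {h} (breaker , (x , y)) play (_ , _ , sb)) =
    BreakerMove.invariant-breaker h x y (invariant 1≤b play) (λ lm → SB-target lm (sb refl))

-- Degeneracy only guarantees that every vertex has a rank, which is assumed directly.
corollary9 : {n : ℕ} (b : ℕ) → 1 ≤ b → (G : Graph n) → Degenerate (b + 1) G →
    (ρ : Fin n → ℕ) → (∀ v → IsRank b G v (ρ v)) →
    (h : Game.History b G ρ) → Game.Play b G ρ h →
    (u : Fin n) (xs : List (Fin n)) → Unique xs → All (Game.SameH b G ρ h u) xs →
    length xs ≤ 2 * (b + 1)
corollary9 b 1≤b G _ ρ ρ-rank h play u xs unique in-comp =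
  proj₁ (ComponentBound.invariant b G ρ ρ-rank 1≤b play u xs unique in-comp)
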